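{- Let $G$ be a finite simple connected graph and let $e \in E(G)$ be an edge that is not a cut edge of $G$. Then $$\chi_{dd}(G)-1 \leq \chi_{dd}(G-e) \leq \chi_{dd}(G)+2.$$
   Context: All graphs are finite, simple, undirected and connected. For a vertex $v$, $N[v]$ denotes its closed neighborhood. A proper coloring of $G$ partitions $V(G)$ into independent sets $V_1,\dots,V_k$ (color classes). A vertex $u$ dominates a color class $V_i$ if $V_i \subseteq N[u]$ (so $u$ dominates its own class only when that class is $\{u\}$). A domination coloring of $G$ is a proper vertex coloring such that every vertex of $G$ dominates at least one color class, and every color class is dominated by at least one vertex. The domination chromatic number $\chi_{dd}(G)$ is the minimum number of color classes in a domination coloring of $G$. $G-e$ is the graph obtained from $G$ by removing the edge $e$ (keeping all vertices). -}

module Defs where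

open import Data.Nat using (ℕ; _<_)
open import Data.Fin using (Fin)
open import Data.Bool using (Bool; true; false; _∧_; not)
open import Data.Fin.Properties using (_≟_)
open import Relation.Nullary.Decidable using (⌊_⌋)
open import Data.Product using (Σ; ∃; _×_; _,_)
open import Data.Sum using (_⊎_)
open import Data.List using (List; []; _∷_)
open import Relation.Binary.PropositionalEquality using (_≡_; _≢_)
open import Relation.Nullary using (¬_)

record Graph (n : ℕ) : Set where
  field
    adj   : Fin n → Fin n → Bool
    sym   : ∀ u v → adj u v ≡ adj v u
    irrefl : ∀ v → adj v v ≡ false
open Graph public

Adj : ∀ {n} → Graph n → Fin n → Fin n → Set
Adj G u v = adj G u v ≡ true

data Walk {n} (G : Graph n) : Fin n → Fin n → Set where
  here : ∀ {u} → Walk G u u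
  step : ∀ {u w v} → Adj G u w → Walk G w v → Walk G u v

Connected : ∀ {n} → Graph n → Set
Connected G = ∀ u v → Walk G u v

IsEdge : ∀ {n} → Graph n → Fin n → Fin n → Set
IsEdge G a b = Adj G a b

removeEdge : ∀ {n} → (G : Graph n) → Fin n → Fin n → Graph n
removeEdge {n} G a b = record
  { adj = adj′
  ; sym = sym′
  ; irrefl = irr′ }
  where
  isE : Fin n → Fin n → Bool
  isE u v = (⌊ u ≟ a ⌋ ∧ ⌊ v ≟ b ⌋) Data.Bool.∨ (⌊ u ≟ b ⌋ ∧ ⌊ v ≟ a ⌋)
  adj′ : Fin n → Fin n → Bool
  adj′ u v = adj G u v ∧ not (isE u v)
  open import Data.Bool.Properties using (∨-comm)
  open import Relation.Binary.PropositionalEquality using (cong₂)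
  sym′ : ∀ u v → adj′ u v ≡ adj′ v u
  sym′ u v = cong₂ (λ x y → x ∧ not y) (Graph.sym G u v)
    (trans (∨-comm (⌊ u ≟ a ⌋ ∧ ⌊ v ≟ b ⌋) (⌊ u ≟ b ⌋ ∧ ⌊ v ≟ a ⌋)) helper)
    where
    open import Relation.Binary.PropositionalEquality using (trans)
    open import Data.Bool.Properties using (∧-comm)
    helper : (⌊ u ≟ b ⌋ ∧ ⌊ v ≟ a ⌋) Data.Bool.∨ (⌊ u ≟ a ⌋ ∧ ⌊ v ≟ b ⌋) ≡ isE v u
    helper = cong₂ Data.Bool._∨_ (∧-comm ⌊ u ≟ b ⌋ ⌊ v ≟ a ⌋) (∧-comm ⌊ u ≟ a ⌋ ⌊ v ≟ b ⌋)
  irr′ : ∀ v → adj′ v v ≡ false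
  irr′ v rewrite irrefl G v = Relation.Binary.PropositionalEquality.refl

-- Colorings: c : Fin n → Fin k; classes V_i = c⁻¹(i). Surjectivity makes
-- exactly k (nonempty) color classes.
Proper : ∀ {n k} → Graph n → (Fin n → Fin k) → Set
Proper G c = ∀ u v → Adj G u v → c u ≢ c v

Surj : ∀ {n k} → (Fin n → Fin k) → Set
Surj {n} {k} c = ∀ (i : Fin k) → ∃ λ v → c v ≡ i

Dominates : ∀ {n k} → Graph n → (Fin n → Fin k) → Fin n → Fin k → Set
Dominates G c u i = ∀ v → c v ≡ i → (v ≡ u) ⊎ Adj G u v

record DomColoring {n} (G : Graph n) (k : ℕ) : Set where
  field
    col        : Fin n → Fin k
    proper     : Proper G col
    surj       : Surj col
    vtxDom     : ∀ u → ∃ λ i → Dominates G col u i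
    classDomd  : ∀ i → ∃ λ u → Dominates G col u i

IsChiDD : ∀ {n} → Graph n → ℕ → Set
IsChiDD G k = DomColoring G k × (∀ m → m < k → ¬ DomColoring G m)

-- Both bounds compare χ_dd against colorings built from an optimal coloring of
-- the other graph.  Such constructions naturally produce *weak* domination
-- colorings, in which some colour classes may be empty; the first general fact
-- is that a weak domination coloring with m colours can be compressed, by
-- deleting empty classes, to a domination coloring with at most m colours, so
-- χ_dd(G) ≤ m.  The second is that "isolating" a vertex a (moving it to a new
-- singleton class) preserves being a weak domination coloring.  Finally, once a
-- is a singleton class the edge ab may be added back, and once a and b both are
-- singleton classes it may be deleted, without destroying the property.
--   Lower bound: isolate a in an optimal coloring of G - ab (k′ + 1 colours),
--   then add ab back.
--   Upper bound: isolate a and b in an optimal coloring of G (k + 2 colours),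
--   then delete ab.
module Submission where

open import Defs hiding (sym)
open import Data.Nat using (ℕ; zero; suc; _≤_; _+_)
open import Data.Nat.Properties using (≤-refl; ≤-trans; ≤-reflexive; m≤n⇒m≤1+n; ≮⇒≥; +-comm)
open import Data.Fin using (Fin; punchOut; punchIn)
open import Data.Fin.Properties
  using (_≟_; suc-injective; punchOut-injective; punchIn-punchOut; any?; all?; ¬∀⟶∃¬)
open import Data.Bool using (true; false; _∧_; _∨_; not)
open import Data.Product using (_×_; _,_; ∃)
open import Data.Sum using (_⊎_; inj₁; inj₂; map₂)
open import Data.Empty using (⊥; ⊥-elim)
open import Relation.Nullary using (¬_; Dec; yes; no)
open import Relation.Nullary.Decidable using (⌊_⌋; _×-dec_)
open import Relation.Binary.PropositionalEquality using (_≡_; _≢_; refl; sym; trans; cong; cong₂; subst)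

private
  variable
    n m : ℕ

adj-distinct : (G : Graph n) {u v : Fin n} → Adj G u v → u ≢ v
adj-distinct G {u} h refl with trans (sym h) (irrefl G u)
... | ()

module _ (G : Graph n) (a b : Fin n) where

  removeEdge-⊆ : ∀ {u v} → Adj (removeEdge G a b) u v → Adj G u v
  removeEdge-⊆ {u} {v} h with adj G u v
  ... | true  = refl
  ... | false = h

  private
    notBoth : {x y z w : Fin n} → ¬ (x ≡ y × z ≡ w) → ⌊ x ≟ y ⌋ ∧ ⌊ z ≟ w ⌋ ≡ false
    notBoth {x} {y} {z} {w} p with x ≟ y | z ≟ w
    ... | yes e₁ | yes e₂ = ⊥-elim (p (e₁ , e₂))
    ... | yes _  | no _   = refl
    ... | no _   | _      = refl

  removeEdge-keeps : ∀ {u v} → Adj G u v → ¬ (u ≡ a × v ≡ b) → ¬ (u ≡ b × v ≡ a) →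
                     Adj (removeEdge G a b) u v
  removeEdge-keeps h p q = cong₂ (λ x y → x ∧ not y) h (cong₂ _∨_ (notBoth p) (notBoth q))

  kept-or-removed : ∀ {u v} → Adj G u v →
    Adj (removeEdge G a b) u v ⊎ ((u ≡ a × v ≡ b) ⊎ (u ≡ b × v ≡ a))
  kept-or-removed {u} {v} h with (u ≟ a) ×-dec (v ≟ b) | (u ≟ b) ×-dec (v ≟ a)
  ... | yes p | _     = inj₂ (inj₁ p)
  ... | no _  | yes q = inj₂ (inj₂ q)
  ... | no p  | no q  = inj₁ (removeEdge-keeps h p q)

-- A weak domination coloring: a domination coloring except that colour classes
-- may be empty; each vertex must still dominate a *nonempty* class, namely the
-- class of some vertex w.
record WeakDomColoring (G : Graph n) (m : ℕ) : Set where
  field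
    col       : Fin n → Fin m
    proper    : Proper G col
    vtxDom    : ∀ u → ∃ λ w → Dominates G col u (col w)
    classDomd : ∀ i → ∃ λ u → Dominates G col u i
open WeakDomColoring

toWeak : {G : Graph n} → DomColoring G m → WeakDomColoring G m
toWeak D .col       = DomColoring.col D
toWeak D .proper    = DomColoring.proper D
toWeak D .classDomd = DomColoring.classDomd D
toWeak D .vtxDom u with DomColoring.vtxDom D u
... | i , dom with DomColoring.surj D i
... | w , refl = w , dom

dropEmptyClass : {G : Graph n} (W : WeakDomColoring G (suc m)) (i : Fin (suc m)) →
                 (∀ v → col W v ≢ i) → WeakDomColoring G m
dropEmptyClass {n} {m} W i empty = record
  { col       = col′
  ; proper    = λ u v h e → proper W u v h (punchOut-injective (avoid u) (avoid v) e)
  ; vtxDom    = λ u → let (w , dom) = vtxDom W u in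
                      w , λ v e → dom v (punchOut-injective (avoid v) (avoid w) e)
  ; classDomd = λ j → let (u , dom) = classDomd W (punchIn i j) in
                      u , λ v e → dom v (back v j e)
  }
  where
  avoid : ∀ v → i ≢ col W v
  avoid v e = empty v (sym e)
  col′ : Fin n → Fin m
  col′ v = punchOut (avoid v)
  back : ∀ v j → col′ v ≡ j → col W v ≡ punchIn i j
  back v j e = trans (sym (punchIn-punchOut (avoid v))) (cong (punchIn i) e)

compress : {G : Graph n} → WeakDomColoring G m → ∃ λ m′ → m′ ≤ m × DomColoring G m′
compress {m = m} W with all? (λ i → any? (λ v → col W v ≟ i))
... | yes surj = m , ≤-refl , record
  { col = col W ; proper = proper W ; surj = surj
  ; vtxDom = λ u → let (w , dom) = vtxDom W u in col W w , dom
  ; classDomd = classDomd W }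
compress {m = zero}  W | no notSurj = ⊥-elim (notSurj λ ())
compress {m = suc m} W | no notSurj
  with ¬∀⟶∃¬ (suc m) _ (λ i → any? (λ v → col W v ≟ i)) notSurj
... | i , noPreimage with compress (dropEmptyClass W i (λ v e → noPreimage (v , e)))
...   | m′ , m′≤m , D = m′ , m≤n⇒m≤1+n m′≤m , D

chiDD-≤-weak : {G : Graph n} {k : ℕ} → IsChiDD G k → WeakDomColoring G m → k ≤ m
chiDD-≤-weak (_ , minimal) W with compress W
... | m′ , m′≤m , D = ≤-trans (≮⇒≥ (λ m′<k → minimal m′ m′<k D)) m′≤m

Alone : (Fin n → Fin m) → Fin n → Set
Alone c a = ∀ v → c v ≡ c a → v ≡ a

dominates-singleton : (G : Graph n) {c : Fin n → Fin m} {a u : Fin n} → Alone c a →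
                      (a ≡ u ⊎ Adj G u a) → Dominates G c u (c a)
dominates-singleton G alone near v e with alone v e
... | refl = near

isolate : (Fin n → Fin m) → Fin n → Fin n → Fin (suc m)
isolate c a v with v ≟ a
... | yes _ = Fin.zero
... | no _  = Fin.suc (c v)

module _ (c : Fin n → Fin m) (a : Fin n) where

  isolate-at : isolate c a a ≡ Fin.zero
  isolate-at with a ≟ a
  ... | yes _ = refl
  ... | no a≢a = ⊥-elim (a≢a refl)

  isolate-off : ∀ {v} → v ≢ a → isolate c a v ≡ Fin.suc (c v)
  isolate-off {v} v≢a with v ≟ a
  ... | yes v≡a = ⊥-elim (v≢a v≡a)
  ... | no _    = refl

  isolate-zero : ∀ {v} → isolate c a v ≡ Fin.zero → v ≡ a
  isolate-zero {v} e with v ≟ a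
  ... | yes v≡a = v≡a
  isolate-zero {v} () | no _

  isolate-suc : ∀ {v i} → isolate c a v ≡ Fin.suc i → v ≢ a × c v ≡ i
  isolate-suc {v} e with v ≟ a
  isolate-suc {v} () | yes _
  ... | no v≢a = v≢a , suc-injective e

  isolate-alone : Alone (isolate c a) a
  isolate-alone v e = isolate-zero (trans e isolate-at)

  isolate-keeps-alone : ∀ {x} → Alone c x → Alone (isolate c a) x
  isolate-keeps-alone {x} alone = byCases (x ≟ a)
    where
    byCases : Dec (x ≡ a) → Alone (isolate c a) x
    byCases (yes refl) = isolate-alone
    byCases (no x≢a) v e = let (_ , cv≡cx) = isolate-suc (trans e (isolate-off x≢a)) in alone v cv≡cx

  -- Old classes shrink, so domination of an old class persists.
  isolate-dominates : (G : Graph n) {u : Fin n} {i : Fin m} →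
                      Dominates G c u i → Dominates G (isolate c a) u (Fin.suc i)
  isolate-dominates G dom v e = let (_ , cv≡i) = isolate-suc e in dom v cv≡i

-- The only delicate
-- case is a vertex u whose dominated class was witnessed only by a: then u lies
-- in N[a] and dominates the new singleton {a} instead.
isolateWeak : {G : Graph n} → WeakDomColoring G m → Fin n → WeakDomColoring G (suc m)
isolateWeak {G = G} W a = record
  { col = c′ ; proper = proper′ ; vtxDom = vtxDom′ ; classDomd = classDomd′ }
  where
  c  = col W
  c′ = isolate c a

  singleton : ∀ {u} → a ≡ u ⊎ Adj G u a → Dominates G c′ u (c′ a)
  singleton = dominates-singleton G (isolate-alone c a)

  proper′ : Proper G c′
  proper′ u v h e = byCases (u ≟ a) (v ≟ a)
    where
    byCases : Dec (u ≡ a) → Dec (v ≡ a) → ⊥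
    byCases (yes u≡a) _ =
      adj-distinct G h (trans u≡a (sym (isolate-alone c a v (trans (sym e) (cong c′ u≡a)))))
    byCases (no u≢a) (yes v≡a) = u≢a (isolate-alone c a u (trans e (cong c′ v≡a)))
    byCases (no u≢a) (no v≢a) =
      proper W u v h (suc-injective (trans (sym (isolate-off c a u≢a)) (trans e (isolate-off c a v≢a))))

  vtxDom′ : ∀ u → ∃ λ w → Dominates G c′ u (c′ w)
  vtxDom′ u = byCases (u ≟ a) (vtxDom W u)
    where
    byCases : Dec (u ≡ a) → (∃ λ w → Dominates G c u (c w)) → ∃ λ w → Dominates G c′ u (c′ w)
    byCases (yes refl) _ = a , singleton (inj₁ refl)
    byCases (no u≢a) (w , dom) = witness (w ≟ a)
      where
      witness : Dec (w ≡ a) → ∃ λ w′ → Dominates G c′ u (c′ w′)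
      witness (no w≢a) =
        w , subst (Dominates G c′ u) (sym (isolate-off c a w≢a)) (isolate-dominates c a G dom)
      witness (yes refl) with dom a refl
      ... | inj₁ a≡u = ⊥-elim (u≢a (sym a≡u))
      ... | inj₂ h   = a , singleton (inj₂ h)

  classDomd′ : ∀ j → ∃ λ u → Dominates G c′ u j
  classDomd′ Fin.zero    = a , subst (Dominates G c′ a) (isolate-at c a) (singleton (inj₁ refl))
  classDomd′ (Fin.suc i) = let (u , dom) = classDomd W i in u , isolate-dominates c a G dom

module _ (G : Graph n) (a b : Fin n) (ab : Adj G a b) where

  private
    H = removeEdge G a b

  -- Adding ab back: properness holds since a and b get different colours,
  -- and domination only gets easier in a supergraph.
  addEdge : (W : WeakDomColoring H m) → Alone (col W) a → WeakDomColoring G m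
  addEdge W aloneA = record
    { col = col W ; proper = proper′
    ; vtxDom = λ u → let (w , dom) = vtxDom W u in w , grow dom
    ; classDomd = λ i → let (u , dom) = classDomd W i in u , grow dom }
    where
    grow : ∀ {u i} → Dominates H (col W) u i → Dominates G (col W) u i
    grow dom v e = map₂ (removeEdge-⊆ G a b) (dom v e)

    proper′ : Proper G (col W)
    proper′ u v h e with kept-or-removed G a b h
    ... | inj₁ h′ = proper W u v h′ e
    ... | inj₂ (inj₁ (refl , refl)) = adj-distinct G ab (sym (aloneA b (sym e)))
    ... | inj₂ (inj₂ (refl , refl)) = adj-distinct G ab (sym (aloneA b e))

  -- Deleting ab: a class other than {a}, {b} has no member in {a, b}, and a
  -- vertex other than a, b is not an endpoint of ab, so no domination used ab;
  -- the singletons {a}, {b} dominate themselves.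
  deleteEdge : (W : WeakDomColoring G m) → Alone (col W) a → Alone (col W) b →
               WeakDomColoring H m
  deleteEdge W aloneA aloneB = record
    { col = c ; proper = λ u v h → proper W u v (removeEdge-⊆ G a b h)
    ; vtxDom = vtxDom′ ; classDomd = classDomd′ }
    where
    c = col W

    keep : ∀ {u v} → Adj G u v → (u ≢ a × u ≢ b) ⊎ (v ≢ a × v ≢ b) → Adj H u v
    keep h off with kept-or-removed G a b h | off
    ... | inj₁ h′ | _ = h′
    ... | inj₂ (inj₁ (refl , _)) | inj₁ (u≢a , _) = ⊥-elim (u≢a refl)
    ... | inj₂ (inj₂ (refl , _)) | inj₁ (_ , u≢b) = ⊥-elim (u≢b refl)
    ... | inj₂ (inj₁ (_ , refl)) | inj₂ (_ , v≢b) = ⊥-elim (v≢b refl)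
    ... | inj₂ (inj₂ (_ , refl)) | inj₂ (v≢a , _) = ⊥-elim (v≢a refl)

    vtxDom′ : ∀ u → ∃ λ w → Dominates H c u (c w)
    vtxDom′ u = byCases (u ≟ a) (u ≟ b)
      where
      byCases : Dec (u ≡ a) → Dec (u ≡ b) → ∃ λ w → Dominates H c u (c w)
      byCases (yes refl) _ = a , dominates-singleton H aloneA (inj₁ refl)
      byCases (no _) (yes refl) = b , dominates-singleton H aloneB (inj₁ refl)
      byCases (no u≢a) (no u≢b) =
        let (w , dom) = vtxDom W u in w , λ v e → map₂ (λ h → keep h (inj₁ (u≢a , u≢b))) (dom v e)

    classDomd′ : ∀ i → ∃ λ u → Dominates H c u i
    classDomd′ i with c a ≟ i | c b ≟ i | classDomd W i
    ... | yes refl | _ | _ = a , dominates-singleton H aloneA (inj₁ refl)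
    ... | no _ | yes refl | _ = b , dominates-singleton H aloneB (inj₁ refl)
    ... | no ca≢i | no cb≢i | u , dom = u , λ v e → map₂ (λ h → keep h (inj₂ (off v e))) (dom v e)
      where
      off : ∀ v → c v ≡ i → v ≢ a × v ≢ b
      off v e = (λ { refl → ca≢i e }) , (λ { refl → cb≢i e })

theorem2 : ∀ {n : ℕ} (G : Graph n) → Connected G →
    (a b : Fin n) → IsEdge G a b → Connected (removeEdge G a b) →
    (k k′ : ℕ) → IsChiDD G k → IsChiDD (removeEdge G a b) k′ →
    (k ≤ k′ + 1) × (k′ ≤ k + 2)
theorem2 G _ a b ab _ k k′ (D , minD) (D′ , minD′) = lower , upper
  where
  lower : k ≤ k′ + 1
  lower = ≤-trans (chiDD-≤-weak (D , minD) (addEdge G a b ab W (isolate-alone _ a)))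
                  (≤-reflexive (+-comm 1 k′))
    where W = isolateWeak (toWeak D′) a

  upper : k′ ≤ k + 2
  upper = ≤-trans (chiDD-≤-weak (D′ , minD′) (deleteEdge G a b ab W aloneA aloneB))
                  (≤-reflexive (+-comm 2 k))
    where
    Wa = isolateWeak (toWeak D) a
    W  = isolateWeak Wa b
    aloneA = isolate-keeps-alone (col Wa) b (isolate-alone (col (toWeak D)) a)
    aloneB = isolate-alone (col Wa) b
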